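{- Let $\Sigma$ be any subexponential signature. If each $A_i$, $i=1,\dots,n$, is of the form $\widehat C$ or $\widehat C^\bot$ for some $\mathrm{SMALC}_\Sigma$-formula $C$, and the sequent $\vdash A_1,\dots,A_n$ is derivable in (cut-free) $\mathrm{SCLL}_\Sigma$, then exactly one of $A_1,\dots,A_n$ is of the form $\widehat C$, and all the others are of the form $\widehat C^\bot$.
   Context: A subexponential signature is a tuple $\Sigma = \langle \mathcal{I}, \preceq, \mathcal{W}, \mathcal{C}, \mathcal{E}\rangle$ with $\mathcal{I}$ a finite set of labels, $\preceq$ a preorder on $\mathcal{I}$, $\mathcal{W},\mathcal{C},\mathcal{E}\subseteq\mathcal{I}$ upwardly closed w.r.t. $\preceq$, and $\mathcal{W}\cap\mathcal{C}\subseteq\mathcal{E}$. $\mathrm{SMALC}_\Sigma$-formulae are built from variables $p_1,p_2,\dots$ and $\mathbf{1}$ using $\cdot,\backslash,/,\wedge,\vee$ and ${!}^s$ ($s\in\mathcal{I}$). $\mathrm{SCLL}_\Sigma$: atoms $p_i,\bar p_i$; formulae from atoms and $\mathbf{1},\bot,\top,\mathbf{0}$ using $\otimes$, $\wp$ (par), $\mathbin{\&}$, $\oplus$, ${!}^s$, ${?}^s$. Negation: $p_i^\bot=\bar p_i$, $\bar p_i^\bot=p_i$, $(A\otimes B)^\bot=B^\bot\wp A^\bot$, $(A\wp B)^\bot=B^\bot\otimes A^\bot$, $(A\oplus B)^\bot=A^\bot\mathbin{\&}B^\bot$, $(A\mathbin{\&}B)^\bot=A^\bot\oplus B^\bot$,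 $({!}^sA)^\bot={?}^sA^\bot$, $({?}^sA)^\bot={!}^sA^\bot$, $\mathbf{1}^\bot=\bot$, $\bot^\bot=\mathbf{1}$, $\mathbf{0}^\bot=\top$, $\top^\bot=\mathbf{0}$. Sequents $\vdash\Gamma$, $\Gamma$ a nonempty cyclically ordered sequence ($\vdash\Gamma_1,\Gamma_2$ identified with $\vdash\Gamma_2,\Gamma_1$, no other permutations). Rules of cut-free $\mathrm{SCLL}_\Sigma$ (premises / conclusion): $\vdash A,A^\bot$; $\vdash\Gamma,A$, $\vdash B,\Delta\ /\ \vdash\Gamma,A\otimes B,\Delta$; $\vdash A,B,\Gamma\ /\ \vdash A\wp B,\Gamma$; $\vdash A_1,\Gamma$, $\vdash A_2,\Gamma\ /\ \vdash A_1\mathbin{\&}A_2,\Gamma$; $\vdash A_i,\Gamma\ /\ \vdash A_1\oplus A_2,\Gamma$; $\vdash\mathbf{1}$; $\vdash\Gamma\ /\ \vdash\bot,\Gamma$; $\vdash\top,\Gamma$; $\vdash B,{?}^{s_1}A_1,\dots,{?}^{s_n}A_n\ /\ \vdash{!}^sB,{?}^{s_1}A_1,\dots,{?}^{s_n}A_n$ if $s\preceq s_j$ for all $j$; $\vdash A,\Gamma\ /\ \vdash{?}^sA,\Gamma$; for $s\in\mathcal{W}$: $\vdash\Gamma\ /\ \vdash{?}^sA,\Gamma$; for $s\in\mathcal{C}$: $\vdash{?}^sA,\Gamma,{?}^sA,\Delta\ /\ \vdash{?}^sA,\Gamma,\Delta$; for $s\in\mathcal{E}$: $\vdash\Gamma,{?}^sA,\Delta\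 /\ \vdash{?}^sA,\Gamma,\Delta$. No rule for $\mathbf{0}$; no cut. Translation: $\widehat{p_i}=p_i$, $\widehat{\mathbf{1}}=\mathbf{1}$, $\widehat{A\cdot B}=\widehat A\otimes\widehat B$, $\widehat{A\backslash B}=\widehat A^\bot\wp\widehat B$, $\widehat{B/A}=\widehat B\wp\widehat A^\bot$, $\widehat{A\wedge B}=\widehat A\mathbin{\&}\widehat B$, $\widehat{A\vee B}=\widehat A\oplus\widehat B$, $\widehat{{!}^sA}={!}^s\widehat A$. -}

module Defs where

open import Data.Nat using (ℕ)
open import Data.Fin using (Fin)
open import Data.List using (List; []; _∷_; _++_; map)
open import Data.List.Relation.Unary.All using (All)
open import Data.Product using (_×_; _,_; proj₁; proj₂; ∃)
open import Data.Empty using (⊥)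

record Signature : Set₁ where
  field
    size      : ℕ
    _≼_       : Fin size → Fin size → Set
    ≼-refl    : ∀ s → s ≼ s
    ≼-trans   : ∀ {s t u} → s ≼ t → t ≼ u → s ≼ u
    W C E     : Fin size → Set
    W-up      : ∀ {s t} → s ≼ t → W s → W t
    C-up      : ∀ {s t} → s ≼ t → C s → C t
    E-up      : ∀ {s t} → s ≼ t → E s → E t
    W∩C⊆E     : ∀ {s} → W s → C s → E s

data SMALC (k : ℕ) : Set where
  var  : ℕ → SMALC k
  one  : SMALC k
  _·_  : SMALC k → SMALC k → SMALC k
  _﹨_  : SMALC k → SMALC k → SMALC k
  _⁄_  : SMALC k → SMALC k → SMALC k
  _∧_  : SMALC k → SMALC k → SMALC k
  _∨_  : SMALC k → SMALC k → SMALC k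
  !ˢ   : Fin k → SMALC k → SMALC k

data Fm (k : ℕ) : Set where
  pos  : ℕ → Fm k
  neg  : ℕ → Fm k
  𝟏 ⊥' ⊤ 𝟎 : Fm k
  _⊗_ _⅋_ _&_ _⊕_ : Fm k → Fm k → Fm k
  ‼ ⁇ : Fin k → Fm k → Fm k

_ᗮ : ∀ {k} → Fm k → Fm k
pos i ᗮ = neg i
neg i ᗮ = pos i
(A ⊗ B) ᗮ = (B ᗮ) ⅋ (A ᗮ)
(A ⅋ B) ᗮ = (B ᗮ) ⊗ (A ᗮ)
(A ⊕ B) ᗮ = (A ᗮ) & (B ᗮ)
(A & B) ᗮ = (A ᗮ) ⊕ (B ᗮ)
(‼ s A) ᗮ = ⁇ s (A ᗮ)
(⁇ s A) ᗮ = ‼ s (A ᗮ)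
𝟏 ᗮ = ⊥'
⊥' ᗮ = 𝟏
𝟎 ᗮ = ⊤
⊤ ᗮ = 𝟎

⟦_⟧ : ∀ {k} → SMALC k → Fm k
⟦ var i ⟧ = pos i
⟦ one ⟧ = 𝟏
⟦ A · B ⟧ = ⟦ A ⟧ ⊗ ⟦ B ⟧
⟦ A ﹨ B ⟧ = (⟦ A ⟧ ᗮ) ⅋ ⟦ B ⟧
⟦ B ⁄ A ⟧ = ⟦ B ⟧ ⅋ (⟦ A ⟧ ᗮ)
⟦ A ∧ B ⟧ = ⟦ A ⟧ & ⟦ B ⟧
⟦ A ∨ B ⟧ = ⟦ A ⟧ ⊕ ⟦ B ⟧
⟦ !ˢ s A ⟧ = ‼ s ⟦ A ⟧

?ctx : ∀ {k} → List (Fin k × Fm k) → List (Fm k)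
?ctx = map (λ p → ⁇ (proj₁ p) (proj₂ p))

-- Cut-free SCLL_Σ. Sequents are lists read cyclically: the rule `rotate`
-- identifies ⊢ Γ₁,Γ₂ with ⊢ Γ₂,Γ₁.
module _ (Σ : Signature) where
  open Signature Σ

  data SCLL⊢ : List (Fm size) → Set where
    rotate : ∀ Γ₁ Γ₂ → SCLL⊢ (Γ₁ ++ Γ₂) → SCLL⊢ (Γ₂ ++ Γ₁)
    ax     : ∀ A → SCLL⊢ (A ∷ (A ᗮ) ∷ [])
    ⊗R     : ∀ Γ A B Δ → SCLL⊢ (Γ ++ A ∷ []) → SCLL⊢ (B ∷ Δ) → SCLL⊢ (Γ ++ (A ⊗ B) ∷ Δ)
    ⅋R     : ∀ A B Γ → SCLL⊢ (A ∷ B ∷ Γ) → SCLL⊢ ((A ⅋ B) ∷ Γ)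
    &R     : ∀ A₁ A₂ Γ → SCLL⊢ (A₁ ∷ Γ) → SCLL⊢ (A₂ ∷ Γ) → SCLL⊢ ((A₁ & A₂) ∷ Γ)
    ⊕R₁    : ∀ A₁ A₂ Γ → SCLL⊢ (A₁ ∷ Γ) → SCLL⊢ ((A₁ ⊕ A₂) ∷ Γ)
    ⊕R₂    : ∀ A₁ A₂ Γ → SCLL⊢ (A₂ ∷ Γ) → SCLL⊢ ((A₁ ⊕ A₂) ∷ Γ)
    𝟏R     : SCLL⊢ (𝟏 ∷ [])
    ⊥R     : ∀ Γ → SCLL⊢ Γ → SCLL⊢ (⊥' ∷ Γ)
    ⊤R     : ∀ Γ → SCLL⊢ (⊤ ∷ Γ)
    !R     : ∀ s B (Φ : List (Fin size × Fm size)) →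
             All (λ p → s ≼ proj₁ p) Φ →
             SCLL⊢ (B ∷ ?ctx Φ) → SCLL⊢ (‼ s B ∷ ?ctx Φ)
    ?D     : ∀ s A Γ → SCLL⊢ (A ∷ Γ) → SCLL⊢ (⁇ s A ∷ Γ)
    ?W     : ∀ s A Γ → W s → SCLL⊢ Γ → SCLL⊢ (⁇ s A ∷ Γ)
    ?C     : ∀ s A Γ Δ → C s → SCLL⊢ (⁇ s A ∷ Γ ++ ⁇ s A ∷ Δ) → SCLL⊢ (⁇ s A ∷ Γ ++ Δ)
    ?E     : ∀ s A Γ Δ → E s → SCLL⊢ (Γ ++ ⁇ s A ∷ Δ) → SCLL⊢ (⁇ s A ∷ Γ ++ Δ)

IsPos IsNeg : ∀ {k} → Fm k → Set
IsPos {k} A = ∃ λ (C : SMALC k) → A ≡' ⟦ C ⟧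
  where open import Relation.Binary.PropositionalEquality renaming (_≡_ to _≡'_)
IsNeg {k} A = ∃ λ (C : SMALC k) → A ≡' (⟦ C ⟧ ᗮ)
  where open import Relation.Binary.PropositionalEquality renaming (_≡_ to _≡'_)

-- Give every SCLL formula an integer weight: atoms p count 1, atoms p̄ count 0, ⊗ adds the
-- weights of its components and subtracts 1, ⅋ adds them, and A ᗮ always weighs 1 − weight A.
-- Every Ĉ weighs 1 and every Ĉ^⊥ weighs 0, and the subformulas of such formulas are again of
-- one of these two forms. By induction on derivations, a derivable sequent of such formulas has
-- total weight 1: the −1 of ⊗ compensates for its two premises, contraction and weakening only
-- duplicate or discard ?-formulas, which weigh 0, and ⊤ never occurs. Total weight 1 with every
-- weight 0 or 1 means that exactly one formula of the sequent is of the form Ĉ.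
module Submission where

open import Defs
open import Data.Empty using (⊥-elim)
open import Data.Fin using (Fin; zero; suc)
open import Data.Integer using (ℤ; 0ℤ; 1ℤ; _+_; _-_; _≤_; +≤+)
open import Data.Integer.Properties
  using (+-assoc; +-identityˡ; +-identityʳ; +-mono-≤; +-monoʳ-≤; ≤-refl; ≤-reflexive;
         +-0-abelianGroup; +-commutativeSemigroup)
open import Algebra.Properties.AbelianGroup +-0-abelianGroup using (identityʳ-unique)
open import Algebra.Properties.CommutativeSemigroup +-commutativeSemigroup using (x∙yz≈y∙xz)
open import Data.Integer.Tactic.RingSolver using (solve-∀)
open import Data.List using (List; []; _∷_; _++_; length; lookup)
open import Data.List.Membership.Propositional.Properties using (∈-lookup)
open import Data.List.Relation.Binary.Permutation.Propositional as ↭ using (_↭_; ↭-sym)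
open import Data.List.Relation.Binary.Permutation.Propositional.Properties
  using (shift; ++-comm; All-resp-↭)
open import Data.List.Relation.Unary.All as All using (All; []; _∷_)
open import Data.List.Relation.Unary.All.Properties using (++⁺; ++⁻)
open import Data.Nat using (ℕ; z≤n)
open import Data.Product using (Σ-syntax; _×_; _,_)
open import Data.Sum as Sum using (_⊎_; inj₁; inj₂)
open import Function using (_∘_)
open import Relation.Binary.PropositionalEquality
  using (_≡_; _≢_; refl; sym; trans; cong; cong₂; subst; module ≡-Reasoning)
open import Relation.Nullary using (¬_)

private
  variable
    k : ℕ
    A B : Fm k

module _ {a} {X : Set a} (w : X → ℤ) where

  total : List X → ℤ
  total []       = 0ℤ
  total (x ∷ xs) = w x + total xs

  total-++ : ∀ xs ys → total (xs ++ ys) ≡ total xs + total ys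
  total-++ []       ys = sym (+-identityˡ (total ys))
  total-++ (x ∷ xs) ys = trans (cong (w x +_) (total-++ xs ys)) (sym (+-assoc (w x) (total xs) (total ys)))

  total-↭ : ∀ {xs ys} → xs ↭ ys → total xs ≡ total ys
  total-↭ ↭.refl         = refl
  total-↭ (↭.prep x p)   = cong (w x +_) (total-↭ p)
  total-↭ (↭.swap x y p) = trans (cong (λ s → w x + (w y + s)) (total-↭ p)) (x∙yz≈y∙xz (w x) (w y) _)
  total-↭ (↭.trans p q)  = trans (total-↭ p) (total-↭ q)

  module _ {p q} {P : X → Set p} {N : X → Set q}
           (P⇒1 : ∀ {x} → P x → w x ≡ 1ℤ) (N⇒0 : ∀ {x} → N x → w x ≡ 0ℤ) where

    private
      with-head-weight : ∀ x xs {c t} → w x ≡ c → total (x ∷ xs) ≡ t → c + total xs ≡ t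
      with-head-weight x xs {t = t} wx≡c = subst (λ c → c + total xs ≡ t) wx≡c

    total-nonneg : ∀ {xs} → All (λ x → P x ⊎ N x) xs → 0ℤ ≤ total xs
    total-nonneg []            = ≤-refl
    total-nonneg (px⊎nx ∷ pns) = +-mono-≤ (weight-nonneg px⊎nx) (total-nonneg pns)
      where
      weight-nonneg : ∀ {x} → P x ⊎ N x → 0ℤ ≤ w x
      weight-nonneg (inj₁ px) = subst (0ℤ ≤_) (sym (P⇒1 px)) (+≤+ z≤n)
      weight-nonneg (inj₂ nx) = ≤-reflexive (sym (N⇒0 nx))

    total≡0⇒All-N : ∀ {xs} → All (λ x → P x ⊎ N x) xs → total xs ≡ 0ℤ → All N xs
    total≡0⇒All-N []              _  = []
    total≡0⇒All-N {x ∷ xs} (inj₁ px ∷ pns) eq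
      with subst (1ℤ ≤_) (with-head-weight x xs (P⇒1 px) eq) (+-monoʳ-≤ 1ℤ (total-nonneg pns))
    ... | +≤+ ()
    total≡0⇒All-N {x ∷ xs} (inj₂ nx ∷ pns) eq =
      nx ∷ total≡0⇒All-N pns (trans (sym (+-identityˡ _)) (with-head-weight x xs (N⇒0 nx) eq))

    total≡1⇒unique-P : ∀ xs → All (λ x → P x ⊎ N x) xs → total xs ≡ 1ℤ →
                       Σ[ i ∈ Fin (length xs) ] P (lookup xs i) × (∀ j → j ≢ i → N (lookup xs j))
    total≡1⇒unique-P (x ∷ xs) (inj₁ px ∷ pns) eq = zero , px , others
      where
      rest-N : All N xs
      rest-N = total≡0⇒All-N pns (identityʳ-unique 1ℤ (total xs) (with-head-weight x xs (P⇒1 px) eq))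
      others : ∀ j → j ≢ zero → N (lookup (x ∷ xs) j)
      others zero    j≢0 = ⊥-elim (j≢0 refl)
      others (suc j) _   = All.lookup rest-N (∈-lookup j)
    total≡1⇒unique-P (x ∷ xs) (inj₂ nx ∷ pns) eq
      with total≡1⇒unique-P xs pns (trans (sym (+-identityˡ _)) (with-head-weight x xs (N⇒0 nx) eq))
    ... | i , pᵢ , others = suc i , pᵢ , others′
      where
      others′ : ∀ j → j ≢ suc i → N (lookup (x ∷ xs) j)
      others′ zero    _      = nx
      others′ (suc j) j≢1+i = others j (j≢1+i ∘ cong suc)

-- ⊤ and 𝟎 weigh 0 and 1 only so that weight-ᗮ holds for every formula.
weight : Fm k → ℤ
weight (pos _) = 1ℤ
weight (neg _) = 0ℤ
weight 𝟏       = 1ℤ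
weight ⊥'      = 0ℤ
weight ⊤       = 0ℤ
weight 𝟎       = 1ℤ
weight (A ⊗ B) = weight A + weight B - 1ℤ
weight (A ⅋ B) = weight A + weight B
weight (A & _) = weight A
weight (A ⊕ _) = weight A
weight (‼ _ A) = weight A
weight (⁇ _ A) = weight A

weight-ᗮ : (A : Fm k) → weight (A ᗮ) ≡ 1ℤ - weight A
weight-ᗮ (pos _) = refl
weight-ᗮ (neg _) = refl
weight-ᗮ 𝟏       = refl
weight-ᗮ ⊥'      = refl
weight-ᗮ ⊤       = refl
weight-ᗮ 𝟎       = refl
weight-ᗮ (A ⊗ B) rewrite weight-ᗮ A | weight-ᗮ B = dual-⊗ (weight A) (weight B)
  where
  dual-⊗ : ∀ a b → (1ℤ - b) + (1ℤ - a) ≡ 1ℤ - (a + b - 1ℤ)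
  dual-⊗ = solve-∀
weight-ᗮ (A ⅋ B) rewrite weight-ᗮ A | weight-ᗮ B = dual-⅋ (weight A) (weight B)
  where
  dual-⅋ : ∀ a b → (1ℤ - b) + (1ℤ - a) - 1ℤ ≡ 1ℤ - (a + b)
  dual-⅋ = solve-∀
weight-ᗮ (A & _) = weight-ᗮ A
weight-ᗮ (A ⊕ _) = weight-ᗮ A
weight-ᗮ (‼ _ A) = weight-ᗮ A
weight-ᗮ (⁇ _ A) = weight-ᗮ A

charge : List (Fm k) → ℤ
charge = total weight

charge-axiom : (A : Fm k) → charge (A ∷ A ᗮ ∷ []) ≡ 1ℤ
charge-axiom A rewrite +-identityʳ (weight (A ᗮ)) | weight-ᗮ A = a+[1-a]≡1 (weight A)
  where
  a+[1-a]≡1 : ∀ a → a + (1ℤ - a) ≡ 1ℤ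
  a+[1-a]≡1 = solve-∀

charge-⊗ : ∀ (Γ : List (Fm k)) A B Δ →
           charge (Γ ++ A ⊗ B ∷ Δ) ≡ charge (Γ ++ A ∷ []) + charge (B ∷ Δ) - 1ℤ
charge-⊗ Γ A B Δ
  rewrite total-++ weight Γ (A ⊗ B ∷ Δ) | total-++ weight Γ (A ∷ [])
  = rearrange (charge Γ) (weight A) (weight B) (charge Δ)
  where
  rearrange : ∀ g a b d → g + (a + b - 1ℤ + d) ≡ g + (a + 0ℤ) + (b + d) - 1ℤ
  rearrange = solve-∀

charge-weightless : (A : Fm k) (Γ : List (Fm k)) → weight A ≡ 0ℤ → charge (A ∷ Γ) ≡ charge Γ
charge-weightless A Γ w≡0 = trans (cong (_+ charge Γ) w≡0) (+-identityˡ (charge Γ))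

-- Inductive versions of IsPos and IsNeg: unlike those, they can be inverted on the main connective.
data Positive {k} : Fm k → Set
data Negative {k} : Fm k → Set

data Positive where
  pos⁺ : ∀ i → Positive (pos i)
  𝟏⁺   : Positive 𝟏
  ⊗⁺   : Positive A → Positive B → Positive (A ⊗ B)
  ⅋⁺ˡ  : Negative A → Positive B → Positive (A ⅋ B)
  ⅋⁺ʳ  : Positive A → Negative B → Positive (A ⅋ B)
  &⁺   : Positive A → Positive B → Positive (A & B)
  ⊕⁺   : Positive A → Positive B → Positive (A ⊕ B)
  ‼⁺   : ∀ {s} → Positive A → Positive (‼ s A)

data Negative where
  neg⁻ : ∀ i → Negative (neg i)
  ⊥⁻   : Negative ⊥'
  ⅋⁻   : Negative A → Negative B → Negative (A ⅋ B)
  ⊗⁻ˡ  : Negative A → Positive B → Negative (A ⊗ B)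
  ⊗⁻ʳ  : Positive A → Negative B → Negative (A ⊗ B)
  &⁻   : Negative A → Negative B → Negative (A & B)
  ⊕⁻   : Negative A → Negative B → Negative (A ⊕ B)
  ⁇⁻   : ∀ {s} → Negative A → Negative (⁇ s A)

Polarized : Fm k → Set
Polarized A = Positive A ⊎ Negative A

ᗮ-positive : Positive A → Negative (A ᗮ)
ᗮ-negative : Negative A → Positive (A ᗮ)
ᗮ-positive (pos⁺ i)  = neg⁻ i
ᗮ-positive 𝟏⁺        = ⊥⁻
ᗮ-positive (⊗⁺ a b)  = ⅋⁻ (ᗮ-positive b) (ᗮ-positive a)
ᗮ-positive (⅋⁺ˡ a b) = ⊗⁻ˡ (ᗮ-positive b) (ᗮ-negative a)
ᗮ-positive (⅋⁺ʳ a b) = ⊗⁻ʳ (ᗮ-negative b) (ᗮ-positive a)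
ᗮ-positive (&⁺ a b)  = ⊕⁻ (ᗮ-positive a) (ᗮ-positive b)
ᗮ-positive (⊕⁺ a b)  = &⁻ (ᗮ-positive a) (ᗮ-positive b)
ᗮ-positive (‼⁺ a)    = ⁇⁻ (ᗮ-positive a)
ᗮ-negative (neg⁻ i)  = pos⁺ i
ᗮ-negative ⊥⁻        = 𝟏⁺
ᗮ-negative (⅋⁻ a b)  = ⊗⁺ (ᗮ-negative b) (ᗮ-negative a)
ᗮ-negative (⊗⁻ˡ a b) = ⅋⁺ˡ (ᗮ-positive b) (ᗮ-negative a)
ᗮ-negative (⊗⁻ʳ a b) = ⅋⁺ʳ (ᗮ-negative b) (ᗮ-positive a)
ᗮ-negative (&⁻ a b)  = ⊕⁺ (ᗮ-negative a) (ᗮ-negative b)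
ᗮ-negative (⊕⁻ a b)  = &⁺ (ᗮ-negative a) (ᗮ-negative b)
ᗮ-negative (⁇⁻ a)    = ‼⁺ (ᗮ-negative a)

⟦⟧-positive : (C : SMALC k) → Positive ⟦ C ⟧
⟦⟧-positive (var i)  = pos⁺ i
⟦⟧-positive one      = 𝟏⁺
⟦⟧-positive (C · D)  = ⊗⁺ (⟦⟧-positive C) (⟦⟧-positive D)
⟦⟧-positive (C ﹨ D)  = ⅋⁺ˡ (ᗮ-positive (⟦⟧-positive C)) (⟦⟧-positive D)
⟦⟧-positive (D ⁄ C)  = ⅋⁺ʳ (⟦⟧-positive D) (ᗮ-positive (⟦⟧-positive C))
⟦⟧-positive (C ∧ D)  = &⁺ (⟦⟧-positive C) (⟦⟧-positive D)
⟦⟧-positive (C ∨ D)  = ⊕⁺ (⟦⟧-positive C) (⟦⟧-positive D)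
⟦⟧-positive (!ˢ s C) = ‼⁺ (⟦⟧-positive C)

IsPos⇒Positive : IsPos A → Positive A
IsPos⇒Positive (C , refl) = ⟦⟧-positive C

IsNeg⇒Negative : IsNeg A → Negative A
IsNeg⇒Negative (C , refl) = ᗮ-positive (⟦⟧-positive C)

weight-positive : Positive A → weight A ≡ 1ℤ
weight-negative : Negative A → weight A ≡ 0ℤ
weight-positive (pos⁺ i)  = refl
weight-positive 𝟏⁺        = refl
weight-positive (⊗⁺ a b)  = cong₂ (λ x y → x + y - 1ℤ) (weight-positive a) (weight-positive b)
weight-positive (⅋⁺ˡ a b) = cong₂ _+_ (weight-negative a) (weight-positive b)
weight-positive (⅋⁺ʳ a b) = cong₂ _+_ (weight-positive a) (weight-negative b)
weight-positive (&⁺ a _)  = weight-positive a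
weight-positive (⊕⁺ a _)  = weight-positive a
weight-positive (‼⁺ a)    = weight-positive a
weight-negative (neg⁻ i)  = refl
weight-negative ⊥⁻        = refl
weight-negative (⅋⁻ a b)  = cong₂ _+_ (weight-negative a) (weight-negative b)
weight-negative (⊗⁻ˡ a b) = cong₂ (λ x y → x + y - 1ℤ) (weight-negative a) (weight-positive b)
weight-negative (⊗⁻ʳ a b) = cong₂ (λ x y → x + y - 1ℤ) (weight-positive a) (weight-negative b)
weight-negative (&⁻ a _)  = weight-negative a
weight-negative (⊕⁻ a _)  = weight-negative a
weight-negative (⁇⁻ a)    = weight-negative a

⊗-polarized⁻ : Polarized (A ⊗ B) → Polarized A × Polarized B
⊗-polarized⁻ (inj₁ (⊗⁺ a b))  = inj₁ a , inj₁ b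
⊗-polarized⁻ (inj₂ (⊗⁻ˡ a b)) = inj₂ a , inj₁ b
⊗-polarized⁻ (inj₂ (⊗⁻ʳ a b)) = inj₁ a , inj₂ b

⅋-polarized⁻ : Polarized (A ⅋ B) → Polarized A × Polarized B
⅋-polarized⁻ (inj₁ (⅋⁺ˡ a b)) = inj₂ a , inj₁ b
⅋-polarized⁻ (inj₁ (⅋⁺ʳ a b)) = inj₁ a , inj₂ b
⅋-polarized⁻ (inj₂ (⅋⁻ a b))  = inj₂ a , inj₂ b

&-polarized⁻ : Polarized (A & B) → Polarized A × Polarized B
&-polarized⁻ (inj₁ (&⁺ a b)) = inj₁ a , inj₁ b
&-polarized⁻ (inj₂ (&⁻ a b)) = inj₂ a , inj₂ b

⊕-polarized⁻ : Polarized (A ⊕ B) → Polarized A × Polarized B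
⊕-polarized⁻ (inj₁ (⊕⁺ a b)) = inj₁ a , inj₁ b
⊕-polarized⁻ (inj₂ (⊕⁻ a b)) = inj₂ a , inj₂ b

⊕-balanced : Polarized (A ⊕ B) → weight A ≡ weight B
⊕-balanced (inj₁ (⊕⁺ a b)) = trans (weight-positive a) (sym (weight-positive b))
⊕-balanced (inj₂ (⊕⁻ a b)) = trans (weight-negative a) (sym (weight-negative b))

‼-polarized⁻ : ∀ {s} → Polarized (‼ s A) → Polarized A
‼-polarized⁻ (inj₁ (‼⁺ a)) = inj₁ a

⁇-polarized⁻ : ∀ {s} → Polarized (⁇ s A) → Negative A
⁇-polarized⁻ (inj₂ (⁇⁻ a)) = a

⊤-unpolarized : ¬ Polarized {k} ⊤
⊤-unpolarized (inj₁ ())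
⊤-unpolarized (inj₂ ())

derivable⇒charge≡1 : ∀ {Sig : Signature} {Γ : List (Fm (Signature.size Sig))} →
                   All Polarized Γ → SCLL⊢ Sig Γ → charge Γ ≡ 1ℤ
derivable⇒charge≡1 ps (rotate Γ₁ Γ₂ ⊢Γ) =
  trans (total-↭ weight (++-comm Γ₂ Γ₁)) (derivable⇒charge≡1 (All-resp-↭ (++-comm Γ₂ Γ₁) ps) ⊢Γ)
derivable⇒charge≡1 ps (ax A) = charge-axiom A
derivable⇒charge≡1 ps (⊗R Γ A B Δ ⊢ΓA ⊢BΔ) with ++⁻ Γ ps
... | pΓ , pAB ∷ pΔ with ⊗-polarized⁻ pAB
... | pA , pB = trans (charge-⊗ Γ A B Δ)
                      (cong₂ (λ x y → x + y - 1ℤ) (derivable⇒charge≡1 (++⁺ pΓ (pA ∷ [])) ⊢ΓA)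
                                                  (derivable⇒charge≡1 (pB ∷ pΔ) ⊢BΔ))
derivable⇒charge≡1 (pAB ∷ pΓ) (⅋R A B Γ ⊢ABΓ) with ⅋-polarized⁻ pAB
... | pA , pB = trans (+-assoc (weight A) (weight B) (charge Γ)) (derivable⇒charge≡1 (pA ∷ pB ∷ pΓ) ⊢ABΓ)
derivable⇒charge≡1 (p ∷ pΓ) (&R A₁ A₂ Γ ⊢A₁Γ _) with &-polarized⁻ p
... | pA₁ , _ = derivable⇒charge≡1 (pA₁ ∷ pΓ) ⊢A₁Γ
derivable⇒charge≡1 (p ∷ pΓ) (⊕R₁ A₁ A₂ Γ ⊢A₁Γ) with ⊕-polarized⁻ p
... | pA₁ , _ = derivable⇒charge≡1 (pA₁ ∷ pΓ) ⊢A₁Γ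
derivable⇒charge≡1 (p ∷ pΓ) (⊕R₂ A₁ A₂ Γ ⊢A₂Γ) with ⊕-polarized⁻ p
... | _ , pA₂ = trans (cong (_+ charge Γ) (⊕-balanced p)) (derivable⇒charge≡1 (pA₂ ∷ pΓ) ⊢A₂Γ)
derivable⇒charge≡1 ps 𝟏R = refl
derivable⇒charge≡1 (_ ∷ pΓ) (⊥R Γ ⊢Γ) = trans (+-identityˡ (charge Γ)) (derivable⇒charge≡1 pΓ ⊢Γ)
derivable⇒charge≡1 (p ∷ _) (⊤R Γ) = ⊥-elim (⊤-unpolarized p)
derivable⇒charge≡1 (p ∷ pΓ) (!R s B Φ _ ⊢BΦ) = derivable⇒charge≡1 (‼-polarized⁻ p ∷ pΓ) ⊢BΦ
derivable⇒charge≡1 (p ∷ pΓ) (?D s A Γ ⊢AΓ) = derivable⇒charge≡1 (inj₂ (⁇-polarized⁻ p) ∷ pΓ) ⊢AΓ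
derivable⇒charge≡1 (p ∷ pΓ) (?W s A Γ _ ⊢Γ) =
  trans (charge-weightless (⁇ s A) Γ (weight-negative (⁇-polarized⁻ p))) (derivable⇒charge≡1 pΓ ⊢Γ)
derivable⇒charge≡1 (p ∷ pΓΔ) (?C s A Γ Δ _ ⊢?AΓ?AΔ) = begin
  charge (⁇ s A ∷ Γ ++ Δ)         ≡⟨ charge-weightless (⁇ s A) (⁇ s A ∷ Γ ++ Δ) ?A-weightless ⟨
  charge (⁇ s A ∷ ⁇ s A ∷ Γ ++ Δ) ≡⟨ total-↭ weight duplicate ⟩
  charge (⁇ s A ∷ Γ ++ ⁇ s A ∷ Δ) ≡⟨ derivable⇒charge≡1 (All-resp-↭ duplicate (p ∷ p ∷ pΓΔ)) ⊢?AΓ?AΔ ⟩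
  1ℤ                              ∎
  where
  ?A-weightless : weight (⁇ s A) ≡ 0ℤ
  ?A-weightless = weight-negative (⁇-polarized⁻ p)
  open ≡-Reasoning
  duplicate : ⁇ s A ∷ ⁇ s A ∷ Γ ++ Δ ↭ ⁇ s A ∷ Γ ++ ⁇ s A ∷ Δ
  duplicate = ↭.prep (⁇ s A) (↭-sym (shift (⁇ s A) Γ Δ))
derivable⇒charge≡1 ps (?E s A Γ Δ _ ⊢Γ?AΔ) =
  trans (total-↭ weight unshift) (derivable⇒charge≡1 (All-resp-↭ unshift ps) ⊢Γ?AΔ)
  where
  unshift : ⁇ s A ∷ Γ ++ Δ ↭ Γ ++ ⁇ s A ∷ Δ
  unshift = ↭-sym (shift (⁇ s A) Γ Δ)

IsNeg⇒¬IsPos : IsNeg A → ¬ IsPos A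
IsNeg⇒¬IsPos n p with trans (sym (weight-positive (IsPos⇒Positive p))) (weight-negative (IsNeg⇒Negative n))
... | ()

lemma2 : (Sig : Signature) (Γ : List (Fm (Signature.size Sig))) →
         All (λ A → IsPos A ⊎ IsNeg A) Γ →
         SCLL⊢ Sig Γ →
         Σ[ i ∈ Fin (length Γ) ] (IsPos (lookup Γ i) ×
           ((j : Fin (length Γ)) → ¬ (j ≡ i) → IsNeg (lookup Γ j) × ¬ IsPos (lookup Γ j)))
lemma2 Sig Γ forms ⊢Γ
  with total≡1⇒unique-P weight (weight-positive ∘ IsPos⇒Positive) (weight-negative ∘ IsNeg⇒Negative)
         Γ forms (derivable⇒charge≡1 (All.map (Sum.map IsPos⇒Positive IsNeg⇒Negative) forms) ⊢Γ)
... | i , posᵢ , negs = i , posᵢ , λ j j≢i → negs j j≢i , IsNeg⇒¬IsPos (negs j j≢i)
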